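{- Let $(u,\dot u,\Sigma\dashv\Delta)$ be a generalized category with families over a small category $\mathcal{B}$ with terminal object, where $u\colon\mathcal{U}\to\mathcal{B}$ and $\dot u\colon\dot{\mathcal{U}}\to\mathcal{B}$ are Grothendieck fibrations (with chosen cartesian liftings), and let $\eta$ and $\epsilon$ denote the unit and counit of $\Sigma\dashv\Delta$. Then the following rules hold. (Sbsm) If $\Gamma\vdash a:_g A'$ and $\Gamma\vdash A'\leq_f A$, then $\Gamma\vdash a:_{f\circ g} A$. (Trans) If $\Gamma\vdash A'\leq_f A$ and $\Gamma\vdash A''\leq_g A'$, then $\Gamma\vdash A''\leq_{f\circ g} A$. (Sbst) If $\Gamma.A\vdash B'\leq_f B$ and $\Gamma\vdash a:_g A$, then, writing $\sigma:=\dot u(\Delta g\circ\eta_a)\colon \Gamma\to\Gamma.A$, $B[a]:=\sigma^*B$ and $B'[a]:=\sigma^*B'$, we have $\Gamma\vdash B'[a]\leq_{\sigma^* f} B[a]$, where $\sigma^*f\colon\sigma^*B'\to\sigma^*B$ is the vertical map over $\Gamma$ induced by $f$ on the chosen cartesian liftings. (Wkn) If $\Gamma\vdash A'\leq_f A$ and $\Gamma\vdash B\ \mathsf{type}$, then $\Gamma.B\vdash (u\epsilon_B)^*A'\leq_{(u\epsilon_B)^*f}(u\epsilon_B)^*A$, where $u\epsilon_B\colon\Gamma.B\to\Gamma$.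
   Context: A generalized category with families (gcwf) consists of: a small category $\mathcal{B}$ with terminal object; Grothendieck fibrations $u\colon\mathcal{U}\to\mathcal{B}$ (types) and $\dot u\colon\dot{\mathcal{U}}\to\mathcal{B}$ (terms); a fibration morphism $\Sigma\colon\dot{\mathcal U}\to\mathcal U$ (a functor with $u\Sigma=\dot u$ preserving cartesian arrows) which has a right adjoint functor $\Delta\colon\mathcal U\to\dot{\mathcal U}$ (not required to commute with the projections) such that every component of the unit $\eta$ is $\dot u$-cartesian and every component of the counit $\epsilon$ is $u$-cartesian. An arrow is vertical if its image under the fibration is an identity. Judgements: $\Gamma\vdash A\ \mathsf{type}$ means $u(A)=\Gamma$; $\Gamma\vdash a:A$ means $\dot u(a)=\Gamma$ and $\Sigma a=A$; $\Gamma\vdash A'\leq_f A$ means $f\colon A'\to A$ is an arrow of $\mathcal U$ with $u(f)=\mathrm{id}_\Gamma$; $\Gamma\vdash a:_g A$ means $\dot u(a)=\Gamma$, $u(A)=\Gamma$ and $g\colon\Sigma a\to A$ is an arrow of $\mathcal U$ with $u(g)=\mathrm{id}_\Gamma$. For a type $A$ over $\Gamma$, the context extension is $\Gamma.A:=\dot u(\Delta A)=u(\Sigma\Delta A)$, with projection $u(\epsilon_A)\colon\Gamma.A\to\Gamma$. For $\sigma\colon\Theta\to\Gamma$ and $A$ over $\Gamma$, $\sigma^*A$ denotes the domain of the chosen cartesian lifting of $\sigma$ at $A$. (In the paper, the weakened types $(u\epsilon_B)^*A'$, $(u\epsilon_B)^*A$ in (Wkn) are abbreviated $A'$, $A$.)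 -}

module Defs where

-- Equality of arrows and of objects is propositional equality (strict categories);
-- the K rule (Agda's default) is used so that object equalities behave as in set theory.

open import Level using (Level; _⊔_) renaming (suc to lsuc)
open import Relation.Binary.PropositionalEquality
open import Data.Product using (Σ; Σ-syntax; _×_; _,_; proj₁; proj₂)

record Category (o ℓ : Level) : Set (lsuc (o ⊔ ℓ)) where
  infixr 9 _∘_
  field
    Obj : Set o
    Hom : Obj → Obj → Set ℓ
    id  : ∀ {A} → Hom A A
    _∘_ : ∀ {A B C} → Hom B C → Hom A B → Hom A C
    identityˡ : ∀ {A B} {f : Hom A B} → id ∘ f ≡ f
    identityʳ : ∀ {A B} {f : Hom A B} → f ∘ id ≡ f
    assoc : ∀ {A B C D} {f : Hom A B} {g : Hom B C} {k : Hom C D} →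
            (k ∘ g) ∘ f ≡ k ∘ (g ∘ f)

module _ {o ℓ : Level} (C : Category o ℓ) where
  open Category C

  data HomEq {X Y : Obj} (h : Hom X Y) : {X' Y' : Obj} → Hom X' Y' → Set (o ⊔ ℓ) where
    hrefl : HomEq h h

  IsId : (Γ : Obj) → {X Y : Obj} → Hom X Y → Set (o ⊔ ℓ)
  IsId Γ h = HomEq h (id {Γ})

  HomEq-dom : {X Y X' Y' : Obj} {h : Hom X Y} {h' : Hom X' Y'} → HomEq h h' → X ≡ X'
  HomEq-dom hrefl = refl

  HomEq-cod : {X Y X' Y' : Obj} {h : Hom X Y} {h' : Hom X' Y'} → HomEq h h' → Y ≡ Y'
  HomEq-cod hrefl = refl

  idOver : {X Y : Obj} → X ≡ Y → Hom X Y
  idOver refl = id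

  record Terminal : Set (o ⊔ ℓ) where
    field
      ⊤ : Obj
      ! : ∀ {A} → Hom A ⊤
      !-unique : ∀ {A} (f : Hom A ⊤) → f ≡ !

record Functor {o ℓ o' ℓ'} (C : Category o ℓ) (D : Category o' ℓ') : Set (o ⊔ ℓ ⊔ o' ⊔ ℓ') where
  private
    module C = Category C
    module D = Category D
  field
    F₀ : C.Obj → D.Obj
    F₁ : ∀ {A B} → C.Hom A B → D.Hom (F₀ A) (F₀ B)
    F-id : ∀ {A} → F₁ (C.id {A}) ≡ D.id
    F-∘ : ∀ {A B C'} {f : C.Hom A B} {g : C.Hom B C'} → F₁ (g C.∘ f) ≡ F₁ g D.∘ F₁ f

IdF : ∀ {o ℓ} (C : Category o ℓ) → Functor C C
IdF C = record { F₀ = λ X → X ; F₁ = λ f → f ; F-id = refl ; F-∘ = refl }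

_∘F_ : ∀ {o₁ ℓ₁ o₂ ℓ₂ o₃ ℓ₃} {C : Category o₁ ℓ₁} {D : Category o₂ ℓ₂} {E : Category o₃ ℓ₃} →
       Functor D E → Functor C D → Functor C E
_∘F_ {E = E} G F = record
  { F₀ = λ X → G.F₀ (F.F₀ X)
  ; F₁ = λ f → G.F₁ (F.F₁ f)
  ; F-id = trans (cong G.F₁ F.F-id) G.F-id
  ; F-∘ = trans (cong G.F₁ F.F-∘) G.F-∘ }
  where
    module G = Functor G
    module F = Functor F

record NatTrans {o ℓ o' ℓ'} {C : Category o ℓ} {D : Category o' ℓ'} (F G : Functor C D)
       : Set (o ⊔ ℓ ⊔ o' ⊔ ℓ') where
  private
    module C = Category C
    module D = Category D
    module F = Functor F
    module G = Functor G
  field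
    η : ∀ X → D.Hom (F.F₀ X) (G.F₀ X)
    natural : ∀ {X Y} (f : C.Hom X Y) → η Y D.∘ F.F₁ f ≡ G.F₁ f D.∘ η X

record Adjunction {o ℓ o' ℓ'} {C : Category o ℓ} {D : Category o' ℓ'}
       (F : Functor C D) (G : Functor D C) : Set (o ⊔ ℓ ⊔ o' ⊔ ℓ') where
  private
    module C = Category C
    module D = Category D
    module F = Functor F
    module G = Functor G
  field
    unit   : NatTrans (IdF C) (G ∘F F)
    counit : NatTrans (F ∘F G) (IdF D)
  η : ∀ X → C.Hom X (G.F₀ (F.F₀ X))
  η = NatTrans.η unit
  ε : ∀ Y → D.Hom (F.F₀ (G.F₀ Y)) Y
  ε = NatTrans.η counit
  field
    zig : ∀ X → ε (F.F₀ X) D.∘ F.F₁ (η X) ≡ D.id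
    zag : ∀ Y → G.F₁ (ε Y) C.∘ η (G.F₀ Y) ≡ C.id

module _ {o ℓ o' ℓ'} {E : Category o ℓ} {B : Category o' ℓ'} (p : Functor E B) where
  private
    module E = Category E
    module B = Category B
  open Functor p

  Cartesian : {X Y : E.Obj} → E.Hom X Y → Set (o ⊔ ℓ ⊔ ℓ')
  Cartesian {X} {Y} f =
    ∀ {Z} (g : E.Hom Z Y) (h : B.Hom (F₀ Z) (F₀ X)) → F₁ f B.∘ h ≡ F₁ g →
    Σ[ k ∈ E.Hom Z X ] ((f E.∘ k ≡ g × F₁ k ≡ h) ×
                        (∀ (k' : E.Hom Z X) → f E.∘ k' ≡ g → F₁ k' ≡ h → k' ≡ k))

  record Lifting (Y : E.Obj) {Θ : B.Obj} (σ : B.Hom Θ (F₀ Y)) : Set (o ⊔ ℓ ⊔ o' ⊔ ℓ') where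
    field
      dom  : E.Obj
      arr  : E.Hom dom Y
      over : HomEq B (F₁ arr) σ
      cart : Cartesian arr

  record Fibration : Set (o ⊔ ℓ ⊔ o' ⊔ ℓ') where
    field
      lift : (Y : E.Obj) {Θ : B.Obj} (σ : B.Hom Θ (F₀ Y)) → Lifting Y σ

record FibMorphism {o ℓ o' ℓ' ob ℓb} {E : Category o ℓ} {E' : Category o' ℓ'} {B : Category ob ℓb}
       (p : Functor E B) (q : Functor E' B) (F : Functor E E') : Set (o ⊔ ℓ ⊔ o' ⊔ ℓ' ⊔ ob ⊔ ℓb) where
  private
    module E = Category E
    module p = Functor p
    module q = Functor q
    module F = Functor F
  field
    over-obj : ∀ X → q.F₀ (F.F₀ X) ≡ p.F₀ X
    over-hom : ∀ {X Y} (f : E.Hom X Y) → HomEq B (q.F₁ (F.F₁ f)) (p.F₁ f)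
    pres-cart : ∀ {X Y} (f : E.Hom X Y) → Cartesian p f → Cartesian q (F.F₁ f)

record GCwF (o ℓ : Level) : Set (lsuc (o ⊔ ℓ)) where
  field
    B  : Category o ℓ
    terminal : Terminal B
    U  : Category o ℓ      -- types
    U̇  : Category o ℓ      -- terms
    u  : Functor U B
    u̇  : Functor U̇ B
    u-fib : Fibration u
    u̇-fib : Fibration u̇
    Sig : Functor U̇ U
    Sig-mor : FibMorphism u̇ u Sig
    Del : Functor U U̇
    adj : Adjunction Sig Del
  open Adjunction adj public using (η; ε)
  field
    η-cart : ∀ X → Cartesian u̇ (η X)
    ε-cart : ∀ A → Cartesian u (ε A)

module Judgements {o ℓ} (G : GCwF o ℓ) where
  open GCwF G
  private
    module B = Category B
    module U = Category U
    module U̇ = Category U̇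
    module u = Functor u
    module u̇ = Functor u̇
    module Sig = Functor Sig
    module Del = Functor Del

  _⊢_type : B.Obj → U.Obj → Set o
  Γ ⊢ A type = u.F₀ A ≡ Γ

  _⊢_∶_ : B.Obj → U̇.Obj → U.Obj → Set o
  Γ ⊢ a ∶ A = (u̇.F₀ a ≡ Γ) × (Sig.F₀ a ≡ A)

  SubJ : (Γ : B.Obj) (A' A : U.Obj) → U.Hom A' A → Set (o ⊔ ℓ)
  SubJ Γ A' A f = IsId B Γ (u.F₁ f)
  syntax SubJ Γ A' A f = Γ ⊢ A' ≤[ f ] A

  TmJ : (Γ : B.Obj) (a : U̇.Obj) (A : U.Obj) → U.Hom (Sig.F₀ a) A → Set (o ⊔ ℓ)
  TmJ Γ a A g = (u̇.F₀ a ≡ Γ) × (u.F₀ A ≡ Γ) × IsId B Γ (u.F₁ g)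
  syntax TmJ Γ a A g = Γ ⊢ a ∶[ g ] A

  -- context extension Γ.A := u̇(Δ A)
  ctx : U.Obj → B.Obj
  ctx A = u̇.F₀ (Del.F₀ A)

  -- σ^*Y: the domain of the chosen cartesian lifting of σ at Y, where the base of Y is
  -- (propositionally) the codomain of σ
  cast : ∀ {Θ G' P} → P ≡ G' → B.Hom Θ G' → B.Hom Θ P
  cast e σ = subst (B.Hom _) (sym e) σ

  liftAt : ∀ {Θ G'} (σ : B.Hom Θ G') (Y : U.Obj) (e : u.F₀ Y ≡ G') → Lifting u Y (cast e σ)
  liftAt σ Y e = Fibration.lift u-fib Y (cast e σ)

  pull : ∀ {Θ G'} (σ : B.Hom Θ G') (Y : U.Obj) → u.F₀ Y ≡ G' → U.Obj
  pull σ Y e = Lifting.dom (liftAt σ Y e)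

  private
    cast-HomEq : ∀ {Θ G' P} (e : P ≡ G') (σ : B.Hom Θ G') → HomEq B (cast e σ) σ
    cast-HomEq refl σ = hrefl

    square : ∀ {D D' P P' Θ G'} (a : B.Hom D P) (a' : B.Hom D' P') (fb : B.Hom P' P)
               (σ : B.Hom Θ G') (s : B.Hom Θ P) (s' : B.Hom Θ P')
               (ha : HomEq B a s) (ha' : HomEq B a' s') → HomEq B s σ → HomEq B s' σ →
               HomEq B fb (B.id {G'}) →
               a B.∘ idOver B (trans (HomEq-dom B ha') (sym (HomEq-dom B ha))) ≡ fb B.∘ a'
    square _ _ _ _ _ _ hrefl hrefl hrefl hrefl hrefl =
      trans B.identityʳ (sym B.identityˡ)

  -- σ^*f : σ^*Y' → σ^*Y, the map induced by a vertical f : Y' → Y over G' on the chosen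
  -- cartesian liftings (the unique arrow k over id with lift_Y ∘ k = f ∘ lift_Y')
  pull-map : ∀ {Θ G'} (σ : B.Hom Θ G') {Y' Y : U.Obj} (f : U.Hom Y' Y) (v : IsId B G' (u.F₁ f)) →
             U.Hom (pull σ Y' (HomEq-dom B v)) (pull σ Y (HomEq-cod B v))
  pull-map σ {Y'} {Y} f v =
    proj₁ (Lifting.cart L (f U.∘ Lifting.arr L') h
             (trans (square (u.F₁ (Lifting.arr L)) (u.F₁ (Lifting.arr L')) (u.F₁ f) σ _ _
                        (Lifting.over L) (Lifting.over L')
                        (cast-HomEq (HomEq-cod B v) σ) (cast-HomEq (HomEq-dom B v) σ) v)
                    (sym u.F-∘)))
    where
      L  = liftAt σ Y  (HomEq-cod B v)
      L' = liftAt σ Y' (HomEq-dom B v)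
      h  = idOver B (trans (HomEq-dom B (Lifting.over L')) (sym (HomEq-dom B (Lifting.over L))))

  -- the projection u(ε_A) : Γ.A → Γ (Γ.A = u̇(ΔA) = u(ΣΔA)), for A over Γ
  proj-ext : ∀ {Γ} (A : U.Obj) → Γ ⊢ A type → B.Hom (u.F₀ (Sig.F₀ (Del.F₀ A))) Γ
  proj-ext A e = subst (B.Hom _) e (u.F₁ (ε A))

  subst-sec : (a : U̇.Obj) {A : U.Obj} → U.Hom (Sig.F₀ a) A → B.Hom (u̇.F₀ a) (ctx A)
  subst-sec a g = u̇.F₁ (Del.F₁ g U̇.∘ η a)

  _∘U_ : ∀ {X Y Z} → U.Hom Y Z → U.Hom X Y → U.Hom X Z
  g ∘U f = g U.∘ f

{-# OPTIONS --safe #-}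
module Submission where

-- Every rule asserts that some arrow of U is vertical. Vertical arrows are closed under
-- composition, which gives (Sbsm) and (Trans). The reindexed arrow σ^*f is by construction
-- the factorisation of f ∘ lift through a cartesian lifting along an identity of the base,
-- so it is vertical over the domain of σ; (Sbst) and (Wkn) are the instances σ = u̇(Δg ∘ η_a)
-- and σ = u(ε_B).

open import Defs
open import Data.Product using (_×_; _,_; proj₁; proj₂)
open import Relation.Binary.PropositionalEquality using (_≡_; refl; sym; trans; subst)

module _ {o ℓ} (C : Category o ℓ) where
  open Category C

  IsId-∘ : ∀ {Γ X Y Z} {h : Hom X Y} {k : Hom Y Z} →
           IsId C Γ k → IsId C Γ h → IsId C Γ (k ∘ h)
  IsId-∘ hrefl hrefl = subst (IsId C _) (sym identityˡ) hrefl

  IsId-subst : ∀ {Γ Δ X Y} {h : Hom X Y} → Γ ≡ Δ → IsId C Γ h → IsId C Δ h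
  IsId-subst refl i = i

  IsId-idOver : ∀ {X Y} (e : X ≡ Y) → IsId C X (idOver C e)
  IsId-idOver refl = hrefl

module _ {o ℓ o' ℓ'} {E : Category o ℓ} {B : Category o' ℓ'} (p : Functor E B) where
  open Category E
  open Functor p

  vertical-∘ : ∀ {Γ X Y Z} {f : Hom Y Z} {g : Hom X Y} →
               IsId B Γ (F₁ f) → IsId B Γ (F₁ g) → IsId B Γ (F₁ (f ∘ g))
  vertical-∘ vf vg = subst (IsId B _) (sym F-∘) (IsId-∘ B vf vg)

  cartesian-factor-vertical :
    ∀ {Γ X Y Z} {f : Hom X Y} (c : Cartesian p f) (g : Hom Z Y) (h : Category.Hom B (F₀ Z) (F₀ X))
    (eq : Category._∘_ B (F₁ f) h ≡ F₁ g) →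
    IsId B Γ h → IsId B Γ (F₁ (proj₁ (c g h eq)))
  cartesian-factor-vertical c g h eq =
    subst (IsId B _) (sym (proj₂ (proj₁ (proj₂ (c g h eq)))))

module _ {o ℓ} (G : GCwF o ℓ) where
  open GCwF G
  open Judgements G

  pull-map-vertical :
    ∀ {Θ Γ Y' Y} (σ : Category.Hom B Θ Γ) (f : Category.Hom U Y' Y) (v : Γ ⊢ Y' ≤[ f ] Y) →
    Θ ⊢ pull σ Y' (HomEq-dom B v) ≤[ pull-map σ f v ] pull σ Y (HomEq-cod B v)
  pull-map-vertical {Y' = Y'} {Y} σ f v =
    IsId-subst B (HomEq-dom B (Lifting.over L'))
      (cartesian-factor-vertical u (Lifting.cart L) _ _ _ (IsId-idOver B base-eq))
    where
      L : Lifting u Y (cast (HomEq-cod B v) σ)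
      L = liftAt σ Y (HomEq-cod B v)
      L' : Lifting u Y' (cast (HomEq-dom B v) σ)
      L' = liftAt σ Y' (HomEq-dom B v)
      base-eq : Functor.F₀ u (Lifting.dom L') ≡ Functor.F₀ u (Lifting.dom L)
      base-eq = trans (HomEq-dom B (Lifting.over L')) (sym (HomEq-dom B (Lifting.over L)))

proposition2p1 : ∀ {o ℓ} (G : GCwF o ℓ) →
    let open GCwF G in
    let open Judgements G in
    -- (Sbsm)
    (∀ {Γ a A' A} {g : Category.Hom U (Functor.F₀ Sig a) A'} {f : Category.Hom U A' A} →
       Γ ⊢ a ∶[ g ] A' → Γ ⊢ A' ≤[ f ] A → Γ ⊢ a ∶[ f ∘U g ] A)
    ×
    -- (Trans)
    (∀ {Γ A'' A' A} {f : Category.Hom U A' A} {g : Category.Hom U A'' A'} →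
       Γ ⊢ A' ≤[ f ] A → Γ ⊢ A'' ≤[ g ] A' → Γ ⊢ A'' ≤[ f ∘U g ] A)
    ×
    -- (Sbst)
    (∀ {Γ A B' B₀ a} {f : Category.Hom U B' B₀} {g : Category.Hom U (Functor.F₀ Sig a) A} →
       (v : ctx A ⊢ B' ≤[ f ] B₀) → Γ ⊢ a ∶[ g ] A →
       Γ ⊢ pull (subst-sec a g) B' (HomEq-dom B v)
         ≤[ pull-map (subst-sec a g) f v ]
         pull (subst-sec a g) B₀ (HomEq-cod B v))
    ×
    -- (Wkn)
    (∀ {Γ A' A B₀} {f : Category.Hom U A' A} →
       (v : Γ ⊢ A' ≤[ f ] A) → (e : Γ ⊢ B₀ type) →
       ctx B₀ ⊢ pull (proj-ext B₀ e) A' (HomEq-dom B v)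
         ≤[ pull-map (proj-ext B₀ e) f v ]
         pull (proj-ext B₀ e) A (HomEq-cod B v))
proposition2p1 G =
    (λ { (ea , _ , vg) vf → ea , HomEq-cod B vf , vertical-∘ u vf vg })
  , vertical-∘ u
  , (λ { {a = a} {f} {g} v (ea , _) →
         IsId-subst B ea (pull-map-vertical G (subst-sec a g) f v) })
  -- u(ε_B₀) starts at u(ΣΔB₀), which is Γ.B₀ = u̇(ΔB₀) because Σ lies over the base.
  , (λ {B₀ = B₀} {f} v e →
         IsId-subst B (FibMorphism.over-obj Sig-mor (Functor.F₀ Del B₀))
           (pull-map-vertical G (proj-ext B₀ e) f v))
  where
    open GCwF G
    open Judgements G
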